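{- Let $m\geq 2$ be an integer. Then \[ d_i(m+1)> \frac{4m^2+7m+i+3}{2(m+1-i)(m+1)}d_i(m), \qquad 1 \leq i \leq m-1, \] and \[ d_0(m+1)=\frac{4m+3}{2(m+1)}d_0(m),\qquad d_m(m+1)=\frac{(2m+3)(2m+1)}{2(m+1)}d_m(m) = \frac{(2m+3)(2m+1)}{2(m+1)}\, 2^{ -m}\binom{2m}{m}. \]
   Context: For a nonnegative integer $m$ and $0\le i\le m$, the Boros-Moll coefficients are \[ d_i(m)=2^{ -2m}\sum_{k=i}^m 2^k\binom{2m-2k}{m-k}\binom{m+k}{k}\binom{k}{i}. \] -}

module Defs where

open import Data.Nat using (ℕ; zero; suc; _+_; _*_; _∸_; _^_; NonZero)
open import Data.Nat.Properties using (m^n≢0; m*n≢0)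
open import Data.Nat.Combinatorics using (_C_)
open import Data.List using (map; upTo)
open import Data.Nat.ListAction using (sum)
open import Data.Integer using (+_)
open import Data.Rational using (ℚ; _/_)

-- Σ_{k=i}^{m} f k  (empty if i > m), as a natural-number sum
sumFromTo : ℕ → ℕ → (ℕ → ℕ) → ℕ
sumFromTo i m f = sum (map (λ j → f (i + j)) (upTo (suc m ∸ i)))

bmNum : ℕ → ℕ → ℕ
bmNum i m = sumFromTo i m (λ k →
  2 ^ k * ((2 * m ∸ 2 * k) C (m ∸ k)) * ((m + k) C k) * (k C i))

d : ℕ → ℕ → ℚ
d i m = _/_ (+ bmNum i m) (2 ^ (2 * m)) {{m^n≢0 2 (2 * m)}}


pow2≢0 : (n : ℕ) → NonZero (2 ^ n)
pow2≢0 n = m^n≢0 2 n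

module Submission where

-- Write 4^m d_i(m) as the sum, over the antidiagonal k + j = m with k ≥ i, of
-- F(k, j) = 2^k C(2j, j) C(2k + j, k) C(k, i).  Comparing consecutive binomial coefficients, every
-- summand of level m + 1 splits as a combination of two neighbouring summands of level m, so that
-- (m + 1)(m + 1 - i) times the level-(m + 1) sum telescopes to
--   2 (4m^2 + 7m + i + 3) · (level-m sum) + 4i · Σ_{k + j = m} j F(k, j).
-- The last sum is positive for 1 ≤ i < m and vanishes for i = 0 and i = m, which gives the three claims.

open import Defs
open import Data.Nat using (ℕ; zero; suc; _+_; _*_; _∸_; _^_; _≤_; z≤n; s≤s; NonZero; pred)
import Data.Nat as ℕ
open import Data.Nat.Properties
open import Data.Nat.Combinatorics using (_C_; nCn≡1; nC1≡n; k>n⇒nCk≡0; nCk+nC[k+1]≡[n+1]C[k+1])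
open import Data.Nat.ListAction using (sum)
open import Data.Nat.Tactic.RingSolver using (solve-∀)
open import Data.List using (applyUpTo)
open import Data.List.Properties using (map-applyUpTo)
open import Data.Integer using (+_; +<+)
import Data.Integer as ℤ
import Data.Integer.Properties as ℤ
open import Data.Rational using (_/_; _<_; toℚᵘ)
import Data.Rational as ℚ
open import Data.Rational.Properties using (toℚᵘ-fromℚᵘ; toℚᵘ-injective; toℚᵘ-homo-*; toℚᵘ-cancel-<)
open import Data.Rational.Unnormalised as ℚᵘ using (mkℚᵘ; _≃_; *≡*; *<*)
import Data.Rational.Unnormalised.Properties as ℚᵘ
open import Data.Product using (_×_; _,_)
open import Algebra.Properties.CommutativeSemigroup +-commutativeSemigroup using () renaming (interchange to +-interchange)
open import Relation.Binary.PropositionalEquality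
open ≡-Reasoning

[k+1]*[n+1]C[k+1]≡[n+1]*nCk : ∀ n k → suc k * (suc n C suc k) ≡ suc n * (n C k)
[k+1]*[n+1]C[k+1]≡[n+1]*nCk n zero = begin
  1 * (suc n C 1)  ≡⟨ cong (1 *_) (nC1≡n (suc n)) ⟩
  1 * suc n        ≡⟨ *-comm 1 (suc n) ⟩
  suc n * 1        ∎
[k+1]*[n+1]C[k+1]≡[n+1]*nCk zero (suc k) =
  trans (cong (suc (suc k) *_) (k>n⇒nCk≡0 (s≤s (s≤s (z≤n {k}))))) (*-zeroʳ (suc (suc k)))
[k+1]*[n+1]C[k+1]≡[n+1]*nCk (suc n) (suc k) = begin
  suc (suc k) * (suc (suc n) C suc (suc k))
    ≡⟨ cong (suc (suc k) *_) (sym (nCk+nC[k+1]≡[n+1]C[k+1] (suc n) (suc k))) ⟩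
  suc (suc k) * ((suc n C suc k) + (suc n C suc (suc k)))
    ≡⟨ *-distribˡ-+ (suc (suc k)) (suc n C suc k) _ ⟩
  (suc n C suc k) + suc k * (suc n C suc k) + suc (suc k) * (suc n C suc (suc k))
    ≡⟨ cong₂ (λ x y → (suc n C suc k) + x + y)
         ([k+1]*[n+1]C[k+1]≡[n+1]*nCk n k) ([k+1]*[n+1]C[k+1]≡[n+1]*nCk n (suc k)) ⟩
  (suc n C suc k) + suc n * (n C k) + suc n * (n C suc k)
    ≡⟨ rearrange (suc n C suc k) n (n C k) (n C suc k) ⟩
  (suc n C suc k) + suc n * ((n C k) + (n C suc k))
    ≡⟨ cong (λ x → (suc n C suc k) + suc n * x) (nCk+nC[k+1]≡[n+1]C[k+1] n k) ⟩
  suc (suc n) * (suc n C suc k) ∎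
  where
  rearrange : ∀ c n x y → c + suc n * x + suc n * y ≡ c + suc n * (x + y)
  rearrange = solve-∀

a*[a+k]Ck≡[k+1]*[a+k]C[k+1] : ∀ a k → a * ((a + k) C k) ≡ suc k * ((a + k) C suc k)
a*[a+k]Ck≡[k+1]*[a+k]C[k+1] a k = +-cancelˡ-≡ (suc k * c) _ _ (begin
  suc k * c + a * c                           ≡⟨ sym (*-distribʳ-+ c (suc k) a) ⟩
  (suc k + a) * c                             ≡⟨ cong (λ x → suc x * c) (+-comm k a) ⟩
  suc (a + k) * c                             ≡⟨ sym ([k+1]*[n+1]C[k+1]≡[n+1]*nCk (a + k) k) ⟩
  suc k * (suc (a + k) C suc k)               ≡⟨ cong (suc k *_) (sym (nCk+nC[k+1]≡[n+1]C[k+1] (a + k) k)) ⟩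
  suc k * (c + ((a + k) C suc k))             ≡⟨ *-distribˡ-+ (suc k) c _ ⟩
  suc k * c + suc k * ((a + k) C suc k)       ∎)
  where c = (a + k) C k

[a+1]*[a+k+1]Ck≡[a+k+1]*[a+k]Ck : ∀ a k → suc a * (suc (a + k) C k) ≡ suc (a + k) * ((a + k) C k)
[a+1]*[a+k+1]Ck≡[a+k+1]*[a+k]Ck a k =
  trans (a*[a+k]Ck≡[k+1]*[a+k]C[k+1] (suc a) k) ([k+1]*[n+1]C[k+1]≡[n+1]*nCk (a + k) k)

[j+1]*[2j+2]C[j+1]≡2*[2j+1]*[2j]Cj : ∀ j → suc j * ((2 * suc j) C suc j) ≡ 2 * suc (2 * j) * ((2 * j) C j)
[j+1]*[2j+2]C[j+1]≡2*[2j+1]*[2j]Cj j = *-cancelˡ-≡ _ _ (suc j) (begin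
  suc j * (suc j * ((2 * suc j) C suc j))
    ≡⟨ cong (λ n → suc j * (suc j * (n C suc j))) (2[1+j]≡2+2j j) ⟩
  suc j * (suc j * (suc (suc (2 * j)) C suc j))
    ≡⟨ cong (suc j *_) ([k+1]*[n+1]C[k+1]≡[n+1]*nCk (suc (2 * j)) j) ⟩
  suc j * (suc (suc (2 * j)) * (suc (2 * j) C j))
    ≡⟨ x*[y*z]≡y*[x*z] (suc j) (suc (suc (2 * j))) (suc (2 * j) C j) ⟩
  suc (suc (2 * j)) * (suc j * (suc (2 * j) C j))
    ≡⟨ cong (λ n → suc (suc (2 * j)) * (suc j * (suc n C j))) (2j≡j+j j) ⟩
  suc (suc (2 * j)) * (suc j * (suc (j + j) C j))
    ≡⟨ cong (suc (suc (2 * j)) *_) ([a+1]*[a+k+1]Ck≡[a+k+1]*[a+k]Ck j j) ⟩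
  suc (suc (2 * j)) * (suc (j + j) * ((j + j) C j))
    ≡⟨ cong (λ n → suc (suc (2 * j)) * (suc n * (n C j))) (sym (2j≡j+j j)) ⟩
  suc (suc (2 * j)) * (suc (2 * j) * ((2 * j) C j))
    ≡⟨ finish j ((2 * j) C j) ⟩
  suc j * (2 * suc (2 * j) * ((2 * j) C j)) ∎)
  where
  2[1+j]≡2+2j : ∀ j → 2 * suc j ≡ suc (suc (2 * j))
  2[1+j]≡2+2j = solve-∀
  2j≡j+j : ∀ j → 2 * j ≡ j + j
  2j≡j+j = solve-∀
  x*[y*z]≡y*[x*z] : ∀ x y z → x * (y * z) ≡ y * (x * z)
  x*[y*z]≡y*[x*z] = solve-∀
  finish : ∀ j c → suc (suc (2 * j)) * (suc (2 * j) * c) ≡ suc j * (2 * suc (2 * j) * c)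
  finish = solve-∀

0<nCk : ∀ {n k} → k ≤ n → 0 ℕ.< n C k
0<nCk {n} {zero} _ = s≤s z≤n
0<nCk {suc n} {suc k} (s≤s k≤n) =
  subst (0 ℕ.<_) (nCk+nC[k+1]≡[n+1]C[k+1] n k) (≤-trans (0<nCk k≤n) (m≤m+n _ _))

summand : ℕ → ℕ → ℕ → ℕ
summand i k j = 2 ^ k * ((2 * j) C j) * ((k + j + k) C k) * (k C i)

bmSummand : ℕ → ℕ → ℕ → ℕ
bmSummand i m k = 2 ^ k * ((2 * m ∸ 2 * k) C (m ∸ k)) * ((m + k) C k) * (k C i)

bmSummand≡summand : ∀ i k j → bmSummand i (k + j) k ≡ summand i k j
bmSummand≡summand i k j = cong₂ (λ a b → 2 ^ k * (a C b) * ((k + j + k) C k) * (k C i))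
  (trans (cong (_∸ 2 * k) (*-distribˡ-+ 2 k j)) (m+n∸m≡n (2 * k) (2 * j)))
  (m+n∸m≡n k j)

summand-suc-j : ∀ i k j →
  suc j * suc (k + j) * summand i k (suc j) ≡ 2 * suc (2 * j) * suc (k + j + k) * summand i k j
summand-suc-j i k j = begin
  suc j * suc (k + j) * (2 ^ k * a′ * ((k + suc j + k) C k) * q)
    ≡⟨ cong (λ n → suc j * suc (k + j) * (2 ^ k * a′ * (n C k) * q)) (shift k j) ⟩
  suc j * suc (k + j) * (2 ^ k * a′ * (suc (k + j + k) C k) * q)
    ≡⟨ regroup (2 ^ k) a′ (suc (k + j + k) C k) q (suc j) (suc (k + j)) ⟩
  2 ^ k * q * (suc j * a′) * (suc (k + j) * (suc (k + j + k) C k))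
    ≡⟨ cong₂ (λ x y → 2 ^ k * q * x * y)
         ([j+1]*[2j+2]C[j+1]≡2*[2j+1]*[2j]Cj j) ([a+1]*[a+k+1]Ck≡[a+k+1]*[a+k]Ck (k + j) k) ⟩
  2 ^ k * q * (2 * suc (2 * j) * a) * (suc (k + j + k) * ((k + j + k) C k))
    ≡⟨ ungroup (2 ^ k) q (suc (2 * j)) a (suc (k + j + k)) ((k + j + k) C k) ⟩
  2 * suc (2 * j) * suc (k + j + k) * summand i k j ∎
  where
  a′ = (2 * suc j) C suc j
  a = (2 * j) C j
  q = k C i
  shift : ∀ k j → k + suc j + k ≡ suc (k + j + k)
  shift = solve-∀
  regroup : ∀ p a c q x y → x * y * (p * a * c * q) ≡ p * q * (x * a) * (y * c)
  regroup = solve-∀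
  ungroup : ∀ p q s a w c → p * q * (2 * s * a) * (w * c) ≡ 2 * s * w * (p * a * c * q)
  ungroup = solve-∀

summand-suc-k : ∀ i t j →
  suc j * (suc t + i + j + (suc t + i)) * summand i (t + i) (suc j)
    ≡ suc (2 * j) * suc t * summand i (suc t + i) j
summand-suc-k i t j = *-cancelʳ-≡ _ _ (suc k) (begin
  suc j * (K + j + K) * (2 ^ k * a′ * e * q) * K
    ≡⟨ regroup (2 ^ k) a′ e q (suc j) (K + j + K) K ⟩
  2 ^ k * (suc j * a′) * ((K + j + K) * e) * (K * q)
    ≡⟨ cong (λ n → 2 ^ k * (suc j * a′) * (n * e) * (K * q)) (shift k j) ⟩
  2 ^ k * (suc j * a′) * (suc (k + suc j + k) * e) * (K * q)
    ≡⟨ cong₂ (λ x y → 2 ^ k * x * y * (K * q))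
         ([j+1]*[2j+2]C[j+1]≡2*[2j+1]*[2j]Cj j) (sym ([k+1]*[n+1]C[k+1]≡[n+1]*nCk (k + suc j + k) k)) ⟩
  2 ^ k * (2 * suc (2 * j) * a) * (K * (suc (k + suc j + k) C K)) * (K * q)
    ≡⟨ cong₂ (λ n y → 2 ^ k * (2 * suc (2 * j) * a) * (K * (n C K)) * y)
         (sym (shift k j)) (sym ([a+1]*[a+k+1]Ck≡[a+k+1]*[a+k]Ck t i)) ⟩
  2 ^ k * (2 * suc (2 * j) * a) * (K * ((K + j + K) C K)) * (suc t * (K C i))
    ≡⟨ ungroup (2 ^ k) (suc (2 * j)) a K ((K + j + K) C K) (suc t) (K C i) ⟩
  suc (2 * j) * suc t * summand i K j * K ∎)
  where
  k = t + i
  K = suc k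
  a′ = (2 * suc j) C suc j
  a = (2 * j) C j
  e = (k + suc j + k) C k
  q = k C i
  shift : ∀ k j → suc k + j + suc k ≡ suc (k + suc j + k)
  shift = solve-∀
  regroup : ∀ p a e q x y z → x * y * (p * a * e * q) * z ≡ p * (x * a) * (y * e) * (z * q)
  regroup = solve-∀
  ungroup : ∀ p s a K c t q → p * (2 * s * a) * (K * c) * (t * q) ≡ s * t * (2 * p * a * c * q) * K
  ungroup = solve-∀

summand-suc-k-0 : ∀ i t →
  suc t * summand i (suc t + i) 0 ≡ 4 * suc (2 * (t + i)) * summand i (t + i) 0
summand-suc-k-0 i t = begin
  suc t * (2 ^ K * 1 * ((K + 0 + K) C K) * (K C i))
    ≡⟨ cong (λ n → suc t * (2 ^ K * 1 * (n C K) * (K C i))) (double K) ⟩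
  suc t * (2 ^ K * 1 * ((2 * K) C K) * (K C i))
    ≡⟨ regroup (2 ^ k) ((2 * K) C K) (K C i) (suc t) ⟩
  2 * 2 ^ k * ((2 * K) C K) * (suc t * (K C i))
    ≡⟨ cong (2 * 2 ^ k * ((2 * K) C K) *_) ([a+1]*[a+k+1]Ck≡[a+k+1]*[a+k]Ck t i) ⟩
  2 * 2 ^ k * ((2 * K) C K) * (K * (k C i))
    ≡⟨ regroup′ (2 ^ k) ((2 * K) C K) K (k C i) ⟩
  2 * 2 ^ k * (K * ((2 * K) C K)) * (k C i)
    ≡⟨ cong (λ x → 2 * 2 ^ k * x * (k C i)) ([j+1]*[2j+2]C[j+1]≡2*[2j+1]*[2j]Cj k) ⟩
  2 * 2 ^ k * (2 * suc (2 * k) * ((2 * k) C k)) * (k C i)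
    ≡⟨ cong (λ n → 2 * 2 ^ k * (2 * suc (2 * k) * (n C k)) * (k C i)) (sym (double k)) ⟩
  2 * 2 ^ k * (2 * suc (2 * k) * ((k + 0 + k) C k)) * (k C i)
    ≡⟨ ungroup (2 ^ k) (suc (2 * k)) ((k + 0 + k) C k) (k C i) ⟩
  4 * suc (2 * k) * summand i k 0 ∎
  where
  k = t + i
  K = suc k
  double : ∀ k → k + 0 + k ≡ 2 * k
  double = solve-∀
  regroup : ∀ p c q t → t * (2 * p * 1 * c * q) ≡ 2 * p * c * (t * q)
  regroup = solve-∀
  regroup′ : ∀ p c K q → 2 * p * c * (K * q) ≡ 2 * p * (K * c) * q
  regroup′ = solve-∀
  ungroup : ∀ p s c q → 2 * p * (2 * s * c) * q ≡ 4 * s * (p * 1 * c * q)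
  ungroup = solve-∀

0<summand : ∀ {i k} j → i ≤ k → 0 ℕ.< summand i k j
0<summand {i} {k} j i≤k =
  *-mono-< (*-mono-< (*-mono-< (m^n>0 2 k) (0<nCk (m≤m+n j (j + 0))))
    (0<nCk (≤-trans (m≤m+n k j) (m≤m+n (k + j) k)))) (0<nCk i≤k)

antidiag : (ℕ → ℕ → ℕ) → ℕ → ℕ
antidiag f zero    = f 0 0
antidiag f (suc n) = f 0 (suc n) + antidiag (λ t j → f (suc t) j) n

antidiag-cong : ∀ {f g} n → (∀ t j → t + j ≡ n → f t j ≡ g t j) → antidiag f n ≡ antidiag g n
antidiag-cong zero    f≗g = f≗g 0 0 refl
antidiag-cong (suc n) f≗g =
  cong₂ _+_ (f≗g 0 (suc n) refl) (antidiag-cong n (λ t j eq → f≗g (suc t) j (cong suc eq)))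

antidiag-+ : ∀ f g n → antidiag (λ t j → f t j + g t j) n ≡ antidiag f n + antidiag g n
antidiag-+ f g zero    = refl
antidiag-+ f g (suc n) = trans
  (cong (_+_ (f 0 (suc n) + g 0 (suc n))) (antidiag-+ (λ t → f (suc t)) (λ t → g (suc t)) n))
  (+-interchange (f 0 (suc n)) (g 0 (suc n)) _ _)

antidiag-* : ∀ c f n → antidiag (λ t j → c * f t j) n ≡ c * antidiag f n
antidiag-* c f zero    = refl
antidiag-* c f (suc n) = trans
  (cong (_+_ (c * f 0 (suc n))) (antidiag-* c (λ t → f (suc t)) n))
  (sym (*-distribˡ-+ c (f 0 (suc n)) _))

antidiag-suc : ∀ f n → antidiag f (suc n) ≡ antidiag (λ t j → f t (suc j)) n + f (suc n) 0
antidiag-suc f zero    = refl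
antidiag-suc f (suc n) = trans
  (cong (_+_ (f 0 (suc (suc n)))) (antidiag-suc (λ t → f (suc t)) n))
  (sym (+-assoc (f 0 (suc (suc n))) _ _))

head≤antidiag : ∀ f n → f 0 n ≤ antidiag f n
head≤antidiag f zero    = ≤-refl
head≤antidiag f (suc n) = m≤m+n _ _

sum-applyUpTo≡antidiag : ∀ f n → sum (applyUpTo f (suc n)) ≡ antidiag (λ t _ → f t) n
sum-applyUpTo≡antidiag f zero    = +-identityʳ (f 0)
sum-applyUpTo≡antidiag f (suc n) = cong (_+_ (f 0)) (sum-applyUpTo≡antidiag (λ t → f (suc t)) n)

antidiag-telescope : ∀ (f β γ : ℕ → ℕ → ℕ) n →
  f 0 (suc n) ≡ β 0 n →
  (∀ t j → suc t + j ≡ n → f (suc t) (suc j) ≡ β (suc t) j + γ t (suc j)) →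
  f (suc n) 0 ≡ γ n 0 →
  antidiag f (suc n) ≡ antidiag β n + antidiag γ n
antidiag-telescope f β γ n first middle last = begin
  antidiag f (suc n)                                  ≡⟨ antidiag-suc f n ⟩
  antidiag (λ t j → f t (suc j)) n + f (suc n) 0      ≡⟨ cong₂ _+_ (antidiag-cong n split) last ⟩
  antidiag (λ t j → β t j + γ↓ t j) n + γ n 0         ≡⟨ cong (_+ γ n 0) (antidiag-+ β γ↓ n) ⟩
  antidiag β n + antidiag γ↓ n + γ n 0                ≡⟨ +-assoc (antidiag β n) _ _ ⟩
  antidiag β n + (antidiag γ↓ n + γ n 0)              ≡⟨ cong (_+_ (antidiag β n)) (refill n) ⟩
  antidiag β n + antidiag γ n                         ∎
  where
  γ↓ : ℕ → ℕ → ℕ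
  γ↓ zero    j = 0
  γ↓ (suc t) j = γ t (suc j)

  split : ∀ t j → t + j ≡ n → f t (suc j) ≡ β t j + γ↓ t j
  split zero    j eq = trans (subst (λ j → f 0 (suc j) ≡ β 0 j) (sym eq) first) (sym (+-identityʳ _))
  split (suc t) j eq = middle t j eq

  refill : ∀ m → antidiag γ↓ m + γ m 0 ≡ antidiag γ m
  refill zero    = refl
  refill (suc m) = sym (antidiag-suc γ m)

bmNum-antidiag : ∀ i n {m} → i + n ≡ m → bmNum i m ≡ antidiag (λ t j → summand i (t + i) j) n
bmNum-antidiag i n refl = begin
  bmNum i (i + n)
    ≡⟨ cong sum (map-applyUpTo (λ t → t) (λ t → bmSummand i (i + n) (i + t)) (suc (i + n) ∸ i)) ⟩
  sum (applyUpTo (λ t → bmSummand i (i + n) (i + t)) (suc (i + n) ∸ i))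
    ≡⟨ cong (λ c → sum (applyUpTo (λ t → bmSummand i (i + n) (i + t)) c)) length≡ ⟩
  sum (applyUpTo (λ t → bmSummand i (i + n) (i + t)) (suc n))
    ≡⟨ sum-applyUpTo≡antidiag (λ t → bmSummand i (i + n) (i + t)) n ⟩
  antidiag (λ t _ → bmSummand i (i + n) (i + t)) n
    ≡⟨ antidiag-cong n pointwise ⟩
  antidiag (λ t j → summand i (t + i) j) n ∎
  where
  length≡ : suc (i + n) ∸ i ≡ suc n
  length≡ = trans (cong (_∸ i) (sym (+-suc i n))) (m+n∸m≡n i (suc n))

  reorder : ∀ i t j → i + (t + j) ≡ t + i + j
  reorder = solve-∀

  pointwise : ∀ t j → t + j ≡ n → bmSummand i (i + n) (i + t) ≡ summand i (t + i) j
  pointwise t j refl =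
    trans (cong₂ (bmSummand i) (reorder i t j) (+-comm i t)) (bmSummand≡summand i (t + i) j)

summand-recurrence-first : ∀ i n →
  suc (i + n) * suc n * summand i i (suc n) ≡ 2 * (suc (i + n) + i) * suc (2 * n) * summand i i n
summand-recurrence-first i n = begin
  suc (i + n) * suc n * summand i i (suc n)   ≡⟨ *-comm-first (suc (i + n)) (suc n) _ ⟩
  suc n * suc (i + n) * summand i i (suc n)   ≡⟨ summand-suc-j i i n ⟩
  2 * suc (2 * n) * suc (i + n + i) * summand i i n ≡⟨ rearrange i n (summand i i n) ⟩
  2 * (suc (i + n) + i) * suc (2 * n) * summand i i n ∎
  where
  *-comm-first : ∀ a b x → a * b * x ≡ b * a * x
  *-comm-first = solve-∀
  rearrange : ∀ i n x → 2 * suc (2 * n) * suc (i + n + i) * x ≡ 2 * (suc (i + n) + i) * suc (2 * n) * x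
  rearrange = solve-∀

summand-recurrence : ∀ i t j {n} → suc t + j ≡ n →
  suc (i + n) * suc n * summand i (suc t + i) (suc j)
    ≡ 2 * (suc (i + n) + i) * suc (2 * j) * summand i (suc t + i) j
      + 4 * suc (i + n) * suc (i + n + (t + i)) * summand i (t + i) (suc j)
-- With X = summand i K j, both ratio lemmas express Y and Z as X times a rational function of i, t, j;
-- clearing their denominators u and u′ leaves a polynomial identity.
summand-recurrence i t j refl = *-cancelʳ-≡ _ _ (u * u′) (begin
  α * Y * (u * u′)          ≡⟨ regroup α Y u u′ ⟩
  α * (u * Y) * u′          ≡⟨ cong (λ y → α * y * u′) (summand-suc-j i K j) ⟩
  α * (v * X) * u′          ≡⟨ polynomial i t j X ⟩
  β * X * (u * u′) + γ * (v′ * X) * u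
                            ≡⟨ cong (λ z → β * X * (u * u′) + γ * z * u) (sym (summand-suc-k i t j)) ⟩
  β * X * (u * u′) + γ * (u′ * Z) * u
                            ≡⟨ ungroup β X γ Z u u′ ⟩
  (β * X + γ * Z) * (u * u′) ∎)
  where
  K = suc t + i
  n = suc t + j
  α = suc (i + n) * suc n
  β = 2 * (suc (i + n) + i) * suc (2 * j)
  γ = 4 * suc (i + n) * suc (i + n + (t + i))
  X = summand i K j
  Y = summand i K (suc j)
  Z = summand i (t + i) (suc j)
  u = suc j * suc (K + j)
  v = 2 * suc (2 * j) * suc (K + j + K)
  u′ = suc j * (K + j + K)
  v′ = suc (2 * j) * suc t
  regroup : ∀ a y u w → a * y * (u * w) ≡ a * (u * y) * w
  regroup = solve-∀
  ungroup : ∀ b x c z u w → b * x * (u * w) + c * (w * z) * u ≡ (b * x + c * z) * (u * w)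
  ungroup = solve-∀
  polynomial : ∀ i t j X →
    suc (i + (suc t + j)) * suc (suc t + j) * (2 * suc (2 * j) * suc (suc t + i + j + (suc t + i)) * X)
      * (suc j * (suc t + i + j + (suc t + i)))
    ≡ 2 * (suc (i + (suc t + j)) + i) * suc (2 * j) * X
        * (suc j * suc (suc t + i + j) * (suc j * (suc t + i + j + (suc t + i))))
      + 4 * suc (i + (suc t + j)) * suc (i + (suc t + j) + (t + i)) * (suc (2 * j) * suc t * X)
        * (suc j * suc (suc t + i + j))
  polynomial = solve-∀

summand-recurrence-last : ∀ i n →
  suc (i + n) * suc n * summand i (suc n + i) 0 ≡ 4 * suc (i + n) * suc (i + n + (n + i)) * summand i (n + i) 0
summand-recurrence-last i n = begin
  suc (i + n) * suc n * summand i (suc n + i) 0   ≡⟨ *-assoc (suc (i + n)) (suc n) _ ⟩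
  suc (i + n) * (suc n * summand i (suc n + i) 0) ≡⟨ cong (suc (i + n) *_) (summand-suc-k-0 i n) ⟩
  suc (i + n) * (4 * suc (2 * (n + i)) * summand i (n + i) 0) ≡⟨ rearrange i n (summand i (n + i) 0) ⟩
  4 * suc (i + n) * suc (i + n + (n + i)) * summand i (n + i) 0 ∎
  where
  rearrange : ∀ i n x → suc (i + n) * (4 * suc (2 * (n + i)) * x) ≡ 4 * suc (i + n) * suc (i + n + (n + i)) * x
  rearrange = solve-∀

recurrence-coefficients : ∀ i t j {n} → t + j ≡ n → ∀ x →
  2 * (suc (i + n) + i) * suc (2 * j) * x + 4 * suc (i + n) * suc (i + n + (t + i)) * x
    ≡ 2 * (4 * (i + n) ^ 2 + 7 * (i + n) + i + 3) * x + 4 * i * (j * x)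
recurrence-coefficients i t j refl = polynomial i t j
  where
  polynomial : ∀ i t j x →
    2 * (suc (i + (t + j)) + i) * suc (2 * j) * x + 4 * suc (i + (t + j)) * suc (i + (t + j) + (t + i)) * x
      ≡ 2 * (4 * ((i + (t + j)) * ((i + (t + j)) * 1)) + 7 * (i + (t + j)) + i + 3) * x + 4 * i * (j * x)
  polynomial = solve-∀

bmNum-recurrence : ∀ i n {m} → i + n ≡ m →
  suc m * suc n * bmNum i (suc m)
    ≡ 2 * (4 * m ^ 2 + 7 * m + i + 3) * bmNum i m + 4 * i * antidiag (λ t j → j * summand i (t + i) j) n
bmNum-recurrence i n refl = begin
  c * bmNum i (suc m)                 ≡⟨ cong (c *_) (bmNum-antidiag i (suc n) (+-suc i n)) ⟩
  c * antidiag s (suc n)              ≡⟨ sym (antidiag-* c s (suc n)) ⟩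
  antidiag (λ t j → c * s t j) (suc n)
    ≡⟨ antidiag-telescope (λ t j → c * s t j) β γ n
         (summand-recurrence-first i n) (λ t j → summand-recurrence i t j) (summand-recurrence-last i n) ⟩
  antidiag β n + antidiag γ n         ≡⟨ sym (antidiag-+ β γ n) ⟩
  antidiag (λ t j → β t j + γ t j) n
    ≡⟨ antidiag-cong n (λ t j eq → recurrence-coefficients i t j eq (s t j)) ⟩
  antidiag (λ t j → a * s t j + b * (j * s t j)) n
    ≡⟨ antidiag-+ (λ t j → a * s t j) (λ t j → b * (j * s t j)) n ⟩
  antidiag (λ t j → a * s t j) n + antidiag (λ t j → b * (j * s t j)) n
    ≡⟨ cong₂ _+_ (antidiag-* a s n) (antidiag-* b (λ t j → j * s t j) n) ⟩
  a * antidiag s n + b * antidiag (λ t j → j * s t j) n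
    ≡⟨ cong (λ x → a * x + b * antidiag (λ t j → j * s t j) n) (sym (bmNum-antidiag i n refl)) ⟩
  a * bmNum i m + b * antidiag (λ t j → j * s t j) n ∎
  where
  m = i + n
  c = suc m * suc n
  a = 2 * (4 * m ^ 2 + 7 * m + i + 3)
  b = 4 * i
  s : ℕ → ℕ → ℕ
  s t j = summand i (t + i) j
  β γ : ℕ → ℕ → ℕ
  β t j = 2 * (suc m + i) * suc (2 * j) * s t j
  γ t j = 4 * suc m * suc (m + (t + i)) * s t j

toℚᵘ-/ : ∀ n d .{{_ : NonZero d}} → toℚᵘ ((+ n) / d) ≃ mkℚᵘ (+ n) (pred d)
toℚᵘ-/ n (suc d) = toℚᵘ-fromℚᵘ (mkℚᵘ (+ n) d)

toℚᵘ-/*/ : ∀ a b c d .{{_ : NonZero b}} .{{_ : NonZero d}} →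
  toℚᵘ (((+ a) / b) ℚ.* ((+ c) / d)) ≃ mkℚᵘ (+ a) (pred b) ℚᵘ.* mkℚᵘ (+ c) (pred d)
toℚᵘ-/*/ a b c d =
  ℚᵘ.≃-trans (toℚᵘ-homo-* ((+ a) / b) ((+ c) / d)) (ℚᵘ.*-cong (toℚᵘ-/ a b) (toℚᵘ-/ c d))

+[a*b]*c≡+a*+b*c : ∀ a b c → + (a * b * c) ≡ + a ℤ.* + b ℤ.* + c
+[a*b]*c≡+a*+b*c a b c = trans (ℤ.pos-* (a * b) c) (cong (ℤ._* + c) (ℤ.pos-* a b))

/≡/ : ∀ a b c d .{{_ : NonZero b}} .{{_ : NonZero d}} → a * d ≡ c * b → (+ a) / b ≡ (+ c) / d
/≡/ a (suc b) c (suc d) eq =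
  toℚᵘ-injective (ℚᵘ.≃-trans (toℚᵘ-/ a (suc b)) (ℚᵘ.≃-trans cross (ℚᵘ.≃-sym (toℚᵘ-/ c (suc d)))))
  where
  cross : mkℚᵘ (+ a) b ≃ mkℚᵘ (+ c) d
  cross = *≡* (trans (sym (ℤ.pos-* a (suc d))) (trans (cong +_ eq) (ℤ.pos-* c (suc b))))

/≡/*/ : ∀ a b c d e f .{{_ : NonZero b}} .{{_ : NonZero d}} .{{_ : NonZero f}} →
  a * (d * f) ≡ c * e * b → (+ a) / b ≡ ((+ c) / d) ℚ.* ((+ e) / f)
/≡/*/ a (suc b) c (suc d) e (suc f) eq =
  toℚᵘ-injective (ℚᵘ.≃-trans (toℚᵘ-/ a (suc b)) (ℚᵘ.≃-trans cross (ℚᵘ.≃-sym (toℚᵘ-/*/ c (suc d) e (suc f)))))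
  where
  cross : mkℚᵘ (+ a) b ≃ mkℚᵘ (+ c) d ℚᵘ.* mkℚᵘ (+ e) f
  cross = *≡* (trans (sym (ℤ.pos-* a (suc d * suc f))) (trans (cong +_ eq) (+[a*b]*c≡+a*+b*c c e (suc b))))

/*/</ : ∀ a b c d e f .{{_ : NonZero b}} .{{_ : NonZero d}} .{{_ : NonZero f}} →
  c * e * b ℕ.< a * (d * f) → ((+ c) / d) ℚ.* ((+ e) / f) < (+ a) / b
/*/</ a (suc b) c (suc d) e (suc f) lt = toℚᵘ-cancel-<
  (ℚᵘ.<-respʳ-≃ (ℚᵘ.≃-sym (toℚᵘ-/ a (suc b))) (ℚᵘ.<-respˡ-≃ (ℚᵘ.≃-sym (toℚᵘ-/*/ c (suc d) e (suc f))) cross))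
  where
  cross : mkℚᵘ (+ c) d ℚᵘ.* mkℚᵘ (+ e) f ℚᵘ.< mkℚᵘ (+ a) b
  cross = *<* (subst₂ ℤ._<_ (+[a*b]*c≡+a*+b*c c e (suc b)) (ℤ.pos-* a (suc d * suc f)) (+<+ lt))

2^[2[1+m]]≡4*2^[2m] : ∀ m → 2 ^ (2 * suc m) ≡ 4 * 2 ^ (2 * m)
2^[2[1+m]]≡4*2^[2m] m = trans (cong (2 ^_) (2[1+m]≡2+2m m)) (2*[2*p]≡4*p (2 ^ (2 * m)))
  where
  2[1+m]≡2+2m : ∀ m → 2 * suc m ≡ 2 + 2 * m
  2[1+m]≡2+2m = solve-∀
  2*[2*p]≡4*p : ∀ p → 2 * (2 * p) ≡ 4 * p
  2*[2*p]≡4*p = solve-∀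

d[m+1]≡a/b*d[m] : ∀ i m a b .{{_ : NonZero b}} →
  bmNum i (suc m) * b ≡ 4 * a * bmNum i m → d i (suc m) ≡ (+ a) / b ℚ.* d i m
d[m+1]≡a/b*d[m] i m a b {{b≢0}} eq =
  /≡/*/ N′ (2 ^ (2 * suc m)) a b N p {{m^n≢0 2 (2 * suc m)}} {{b≢0}} {{m^n≢0 2 (2 * m)}} (begin
  N′ * (b * p)         ≡⟨ sym (*-assoc N′ b p) ⟩
  N′ * b * p           ≡⟨ cong (_* p) eq ⟩
  4 * a * N * p        ≡⟨ regroup a N p ⟩
  a * N * (4 * p)      ≡⟨ cong (a * N *_) (sym (2^[2[1+m]]≡4*2^[2m] m)) ⟩
  a * N * 2 ^ (2 * suc m) ∎)
  where
  N′ = bmNum i (suc m)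
  N = bmNum i m
  p = 2 ^ (2 * m)
  regroup : ∀ a N p → 4 * a * N * p ≡ a * N * (4 * p)
  regroup = solve-∀

a/b*d[m]<d[m+1] : ∀ i m a b .{{_ : NonZero b}} →
  4 * a * bmNum i m ℕ.< bmNum i (suc m) * b → (+ a) / b ℚ.* d i m < d i (suc m)
a/b*d[m]<d[m+1] i m a b {{b≢0}} lt =
  /*/</ N′ (2 ^ (2 * suc m)) a b N p {{m^n≢0 2 (2 * suc m)}} {{b≢0}} {{m^n≢0 2 (2 * m)}}
  (subst₂ ℕ._<_ scaled (*-assoc N′ b p) (*-monoˡ-< p {{m^n≢0 2 (2 * m)}} lt))
  where
  N′ = bmNum i (suc m)
  N = bmNum i m
  p = 2 ^ (2 * m)
  regroup : ∀ a N p → 4 * a * N * p ≡ a * N * (4 * p)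
  regroup = solve-∀
  scaled : 4 * a * N * p ≡ a * N * 2 ^ (2 * suc m)
  scaled = trans (regroup a N p) (cong (a * N *_) (sym (2^[2[1+m]]≡4*2^[2m] m)))

d-diagonal : ∀ m → d m m ≡ _/_ (+ ((2 * m) C m)) (2 ^ m) {{pow2≢0 m}}
d-diagonal m = /≡/ (bmNum m m) (2 ^ (2 * m)) ((2 * m) C m) (2 ^ m) {{m^n≢0 2 (2 * m)}} {{pow2≢0 m}} (begin
  bmNum m m * 2 ^ m
    ≡⟨ cong (_* 2 ^ m) (bmNum-antidiag m 0 (+-identityʳ m)) ⟩
  2 ^ m * 1 * ((m + 0 + m) C m) * (m C m) * 2 ^ m
    ≡⟨ cong₂ (λ n c → 2 ^ m * 1 * (n C m) * c * 2 ^ m) (m+0+m≡2m m) (nCn≡1 m) ⟩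
  2 ^ m * 1 * ((2 * m) C m) * 1 * 2 ^ m
    ≡⟨ regroup (2 ^ m) ((2 * m) C m) ⟩
  ((2 * m) C m) * (2 ^ m * 2 ^ m)
    ≡⟨ cong (((2 * m) C m) *_) (sym (trans (cong (2 ^_) (2m≡m+m m)) (^-distribˡ-+-* 2 m m))) ⟩
  ((2 * m) C m) * 2 ^ (2 * m) ∎)
  where
  m+0+m≡2m : ∀ m → m + 0 + m ≡ 2 * m
  m+0+m≡2m = solve-∀
  2m≡m+m : ∀ m → 2 * m ≡ m + m
  2m≡m+m = solve-∀
  regroup : ∀ p c → p * 1 * c * 1 * p ≡ c * (p * p)
  regroup = solve-∀

d-ratio-above : ∀ i n {m} → i + n ≡ m → 1 ≤ i → 1 ≤ n →
  (+ (4 * m ^ 2 + 7 * m + i + 3)) / (2 * suc n * suc m) ℚ.* d i m < d i (suc m)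
d-ratio-above i n {m} i+n≡m 1≤i 1≤n = a/b*d[m]<d[m+1] i m X (2 * suc n * suc m)
  (subst (4 * X * N ℕ.<_) (sym expand) (m<m+n (4 * X * N) (*-mono-< (*-mono-< (0<1+n {7}) 1≤i) 0<W)))
  where
  X = 4 * m ^ 2 + 7 * m + i + 3
  N = bmNum i m
  N′ = bmNum i (suc m)
  W = antidiag (λ t j → j * summand i (t + i) j) n
  0<W : 0 ℕ.< W
  0<W = ≤-trans (*-mono-< 1≤n (0<summand {i} n ≤-refl)) (head≤antidiag (λ t j → j * summand i (t + i) j) n)
  double : ∀ a b c → a * (2 * b * c) ≡ 2 * (c * b * a)
  double = solve-∀
  distribute : ∀ X N i W → 2 * (2 * X * N + 4 * i * W) ≡ 4 * X * N + 8 * i * W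
  distribute = solve-∀
  expand : N′ * (2 * suc n * suc m) ≡ 4 * X * N + 8 * i * W
  expand = begin
    N′ * (2 * suc n * suc m)         ≡⟨ double N′ (suc n) (suc m) ⟩
    2 * (suc m * suc n * N′)         ≡⟨ cong (2 *_) (bmNum-recurrence i n i+n≡m) ⟩
    2 * (2 * X * N + 4 * i * W)      ≡⟨ distribute X N i W ⟩
    4 * X * N + 8 * i * W            ∎

d-ratio-at-0 : ∀ m → d 0 (suc m) ≡ (+ (4 * m + 3)) / (2 * suc m) ℚ.* d 0 m
d-ratio-at-0 m = d[m+1]≡a/b*d[m] 0 m (4 * m + 3) (2 * suc m) (*-cancelˡ-≡ _ _ (suc m) (begin
  suc m * (N′ * (2 * suc m))                  ≡⟨ double N′ (suc m) ⟩
  2 * (suc m * suc m * N′)                    ≡⟨ cong (2 *_) (bmNum-recurrence 0 m refl) ⟩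
  2 * (2 * (4 * m ^ 2 + 7 * m + 0 + 3) * N + 0) ≡⟨ factor m N ⟩
  suc m * (4 * (4 * m + 3) * N)               ∎))
  where
  N = bmNum 0 m
  N′ = bmNum 0 (suc m)
  double : ∀ a s → s * (a * (2 * s)) ≡ 2 * (s * s * a)
  double = solve-∀
  factor : ∀ m N → 2 * (2 * (4 * (m * (m * 1)) + 7 * m + 0 + 3) * N + 0) ≡ suc m * (4 * (4 * m + 3) * N)
  factor = solve-∀

d-ratio-at-diagonal : ∀ m → d m (suc m) ≡ (+ ((2 * m + 3) * (2 * m + 1))) / (2 * suc m) ℚ.* d m m
d-ratio-at-diagonal m = d[m+1]≡a/b*d[m] m m ((2 * m + 3) * (2 * m + 1)) (2 * suc m) (begin
  N′ * (2 * suc m)                                     ≡⟨ double N′ (suc m) ⟩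
  2 * (suc m * 1 * N′)                                 ≡⟨ cong (2 *_) (bmNum-recurrence m 0 (+-identityʳ m)) ⟩
  2 * (2 * (4 * m ^ 2 + 7 * m + m + 3) * N + 4 * m * 0) ≡⟨ factor m N ⟩
  4 * ((2 * m + 3) * (2 * m + 1)) * N                  ∎)
  where
  N = bmNum m m
  N′ = bmNum m (suc m)
  double : ∀ a s → a * (2 * s) ≡ 2 * (s * 1 * a)
  double = solve-∀
  factor : ∀ m N →
    2 * (2 * (4 * (m * (m * 1)) + 7 * m + m + 3) * N + 4 * m * 0) ≡ 4 * ((2 * m + 3) * (2 * m + 1)) * N
  factor = solve-∀

d-ratio-interior : ∀ m i → 1 ≤ i → i ≤ m ∸ 1 →
  (+ (4 * m ^ 2 + 7 * m + i + 3)) / (2 * suc (m ∸ i) * suc m) ℚ.* d i m < d i (suc m)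
d-ratio-interior zero    (suc _) _ ()
d-ratio-interior (suc m) i 1≤i i≤m =
  d-ratio-above i (suc m ∸ i) (m+[n∸m]≡n (m≤n⇒m≤1+n i≤m)) 1≤i (m<n⇒0<n∸m (s≤s i≤m))

theorem2p2 : (m : ℕ) → 2 ≤ m →
    ((i : ℕ) → 1 ≤ i → i ≤ m ∸ 1 →
      (+ (4 * m ^ 2 + 7 * m + i + 3)) / (2 * suc (m ∸ i) * suc m) Data.Rational.* d i m < d i (suc m))
    × (d 0 (suc m) ≡ (+ (4 * m + 3)) / (2 * suc m) Data.Rational.* d 0 m)
    × (d m (suc m) ≡ (+ ((2 * m + 3) * (2 * m + 1))) / (2 * suc m) Data.Rational.* d m m)
    × (d m (suc m) ≡ (+ ((2 * m + 3) * (2 * m + 1))) / (2 * suc m) Data.Rational.* (_/_ (+ ((2 * m) C m)) (2 ^ m) {{pow2≢0 m}}))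
theorem2p2 m _ =
  d-ratio-interior m , d-ratio-at-0 m , d-ratio-at-diagonal m ,
  trans (d-ratio-at-diagonal m) (cong ((+ ((2 * m + 3) * (2 * m + 1))) / (2 * suc m) ℚ.*_) (d-diagonal m))
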